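{- Let $\mathcal{G}$ be the Sprague–Grundy function of Exco-Nim with $n=2$. If a position $x=(x_0,x_1,x_2)$ satisfies $x_0\ge x_1$, then $\mathcal{G}(x)=x_0+x_1+x_2$.
   Context: Exco-Nim with $n=2$: positions are triples $x=(x_0,x_1,x_2)$ of nonnegative integers. A legal move $x\to x'$ is to a triple $x'$ of nonnegative integers with $x'_j\le x_j$ for $j=0,1,2$, $x'_0+x'_1+x'_2<x_0+x_1+x_2$, and $x'_1=x_1$ or $x'_2=x_2$. The Sprague–Grundy function is $\mathcal{G}(x)=\operatorname{mex}\{\mathcal{G}(x'): x\to x'\}$, where $\operatorname{mex}(S)$ is the least nonnegative integer not in $S$. -}

module Defs where

open import Data.Nat using (ℕ; zero; suc; _+_; _≤_; _<_; _≟_; _<?_; _≤?_)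
open import Data.Nat.Properties using (≡-irrelevant)
open import Data.Bool using (Bool; true; false; _∨_; _∧_; if_then_else_)
open import Data.List using (List; []; _∷_; map; concatMap; filter; upTo; any)
open import Data.Product using (_×_; _,_)
open import Relation.Nullary.Decidable using (⌊_⌋)

Pos : Set
Pos = ℕ × ℕ × ℕ

total : Pos → ℕ
total (a , b , c) = a + b + c

isMove : Pos → Pos → Bool
isMove (x0 , x1 , x2) (y0 , y1 , y2) =
  ⌊ y0 ≤? x0 ⌋ ∧ ⌊ y1 ≤? x1 ⌋ ∧ ⌊ y2 ≤? x2 ⌋ ∧
  ⌊ (y0 + y1 + y2) <? (x0 + x1 + x2) ⌋ ∧
  (⌊ y1 ≟ x1 ⌋ ∨ ⌊ y2 ≟ x2 ⌋)

below : Pos → List Pos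
below (x0 , x1 , x2) =
  concatMap (λ a → concatMap (λ b → map (λ c → (a , b , c)) (upTo (suc x2)))
                               (upTo (suc x1)))
            (upTo (suc x0))

moves : Pos → List Pos
moves x = filter (λ y → isMove x y Data.Bool.≟ true) (below x)
  where import Data.Bool

elem : ℕ → List ℕ → Bool
elem k [] = false
elem k (m ∷ ms) = ⌊ k ≟ m ⌋ ∨ elem k ms

-- mex: least natural not in the list (searched from 0; the answer is
-- at most the length of the list, so fuel = length + 1 suffices).
mexFrom : ℕ → ℕ → List ℕ → ℕ
mexFrom zero k l = k
mexFrom (suc f) k l = if elem k l then mexFrom f (suc k) l else k

mex : List ℕ → ℕ
mex l = mexFrom (suc (Data.List.length l)) 0 l
  where import Data.List

-- Sprague–Grundy value with fuel; fuel > total x makes it exact,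
-- since every move strictly decreases the total.
grundyF : ℕ → Pos → ℕ
grundyF zero x = 0
grundyF (suc f) x = mex (map (grundyF f) (moves x))

𝒢 : Pos → ℕ
𝒢 x = grundyF (suc (total x)) x

module Submission where

-- The proof has three layers.
--  * Bridging: the boolean move test and the computed mex are related to a
--    propositional move relation 'Move' and to membership, which yields the
--    two defining properties of a Sprague–Grundy function: no option has the
--    value 𝒢 x, and every value below 𝒢 x is attained by an option.
--  * General consequences: 𝒢 x ≤ total x, and 𝒢 x ≥ k as soon as every value
--    below k is attained by an option ("x covers k").
--  * Exco-Nim specifics: enlarging pile 0 by a adds at least a to the value
--    (a + 𝒢 (0 , b , c) ≤ 𝒢 (a , b , c)), and the column bound
--    c ≤ b + 𝒢 (0 , b , c), proved by strong induction on b.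
-- The theorem follows by induction along moves: a balanced position (b ≤ a)
-- covers its total, values ≥ c being reached by balanced options that keep
-- pile 2, and values < c by lowering pile 0 and invoking the two bounds.

open import Defs
open import Data.Nat using (ℕ; zero; suc; _+_; _∸_; _≤_; _<_; _≟_; _≤?_; _<?_; z≤n; s≤s; s≤s⁻¹)
open import Data.Nat.Properties
open import Data.Nat.Induction using (<-rec)
open import Data.Bool using (true; false; T; _∧_)
open import Data.Bool.Properties using (T-≡; T-∧; T-∨)
open import Data.List using (List; []; _∷_; map; concatMap; upTo; length; _++_)
open import Data.List.Properties using (map-cong-local; length-++-sucʳ)
open import Data.List.Relation.Unary.All using (tabulate)
open import Data.List.Relation.Unary.Any using (here; there)
open import Data.List.Membership.Propositional using (_∈_; _∉_; lose)
open import Data.List.Membership.Propositional.Properties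
open import Data.Product using (_×_; _,_; ∃)
open import Data.Sum using (_⊎_; inj₁; inj₂)
import Data.Sum as Sum
open import Data.Empty using (⊥-elim)
open import Function.Bundles using (Equivalence)
open import Relation.Nullary.Decidable using (yes; no; ⌊_⌋; toWitness; fromWitness)
open import Relation.Binary.PropositionalEquality
import Data.Bool

open Equivalence using (to; from)

data Move : Pos → Pos → Set where
  mv : ∀ {x0 x1 x2 y0 y1 y2} → y0 ≤ x0 → y1 ≤ x1 → y2 ≤ x2 →
       y0 + y1 + y2 < x0 + x1 + x2 → (y1 ≡ x1 ⊎ y2 ≡ x2) →
       Move (x0 , x1 , x2) (y0 , y1 , y2)

move-total : ∀ {x y} → Move x y → total y < total x
move-total (mv _ _ _ t _) = t

isMove⇒Move : ∀ x y → T (isMove x y) → Move x y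
isMove⇒Move (x0 , x1 , x2) (y0 , y1 , y2) t =
  let a , t₁ = split-∧ ⌊ y0 ≤? x0 ⌋ t
      b , t₂ = split-∧ ⌊ y1 ≤? x1 ⌋ t₁
      c , t₃ = split-∧ ⌊ y2 ≤? x2 ⌋ t₂
      s , e = split-∧ ⌊ total<? ⌋ t₃
  in mv (toWitness {a? = y0 ≤? x0} a) (toWitness {a? = y1 ≤? x1} b)
        (toWitness {a? = y2 ≤? x2} c) (toWitness {a? = total<?} s)
        (Sum.map (toWitness {a? = y1 ≟ x1}) (toWitness {a? = y2 ≟ x2}) (to (T-∨ {⌊ y1 ≟ x1 ⌋}) e))
  where
  total<? = (y0 + y1 + y2) <? (x0 + x1 + x2)
  split-∧ : ∀ p {q} → T (p ∧ q) → T p × T q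
  split-∧ p = to (T-∧ {p})

Move⇒isMove : ∀ {x y} → Move x y → T (isMove x y)
Move⇒isMove {x0 , x1 , x2} {y0 , y1 , y2} (mv a b c s e) =
  from T-∧ (fromWitness {a? = y0 ≤? x0} a , from T-∧ (fromWitness {a? = y1 ≤? x1} b ,
  from T-∧ (fromWitness {a? = y2 ≤? x2} c , from T-∧ (fromWitness {a? = total<?} s ,
  from T-∨ (Sum.map (fromWitness {a? = y1 ≟ x1}) (fromWitness {a? = y2 ≟ x2}) e)))))
  where total<? = (y0 + y1 + y2) <? (x0 + x1 + x2)

below⁺ : ∀ {x0 x1 x2 y0 y1 y2} → y0 ≤ x0 → y1 ≤ x1 → y2 ≤ x2 →
         (y0 , y1 , y2) ∈ below (x0 , x1 , x2)
below⁺ {x0} {x1} {x2} {y0} {y1} {y2} a b c =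
  ∈-concatMap⁺ rows (lose (∈-upTo⁺ (s≤s a))
    (∈-concatMap⁺ (column y0) (lose (∈-upTo⁺ (s≤s b))
      (∈-map⁺ (λ c' → (y0 , y1 , c')) (∈-upTo⁺ (s≤s c))))))
  where
  column : ℕ → ℕ → List Pos
  column a' b' = map (λ c' → (a' , b' , c')) (upTo (suc x2))
  rows : ℕ → List Pos
  rows a' = concatMap (column a') (upTo (suc x1))

moves⁺ : ∀ {x y} → Move x y → y ∈ moves x
moves⁺ {x} m@(mv a b c _ _) =
  ∈-filter⁺ (λ y → isMove x y Data.Bool.≟ true) (below⁺ a b c) (to T-≡ (Move⇒isMove m))

moves⁻ : ∀ {x y} → y ∈ moves x → Move x y
moves⁻ {x} {y} p =
  let _ , isMove≡true = ∈-filter⁻ (λ y → isMove x y Data.Bool.≟ true) {xs = below x} p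
  in isMove⇒Move x y (from T-≡ isMove≡true)

elem⇒∈ : ∀ k l → elem k l ≡ true → k ∈ l
elem⇒∈ k [] ()
elem⇒∈ k (m ∷ ms) p with k ≟ m
... | yes refl = here refl
... | no _ = there (elem⇒∈ k ms p)

∈⇒elem : ∀ {k l} → k ∈ l → elem k l ≡ true
∈⇒elem {k} {m ∷ ms} k∈ with k ≟ m | k∈
... | yes _ | _ = refl
... | no k≢m | here k≡m = ⊥-elim (k≢m k≡m)
... | no _ | there k∈ms = ∈⇒elem k∈ms

elem-false⇒∉ : ∀ {k l} → elem k l ≡ false → k ∉ l
elem-false⇒∉ eq k∈ with trans (sym eq) (∈⇒elem k∈)
... | ()

mexFrom-skips : ∀ f k l v → k ≤ v → v < mexFrom f k l → v ∈ l
mexFrom-skips zero k l v k≤v v<k = ⊥-elim (<-irrefl refl (<-≤-trans v<k k≤v))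
mexFrom-skips (suc f) k l v k≤v v<mex with elem k l in k∈?
... | false = ⊥-elim (<-irrefl refl (<-≤-trans v<mex k≤v))
... | true with k ≟ v
...   | yes refl = elem⇒∈ k l k∈?
...   | no k≢v = mexFrom-skips f (suc k) l v (≤∧≢⇒< k≤v k≢v) v<mex

mexFrom-stops : ∀ f k l → mexFrom f k l ∉ l ⊎ mexFrom f k l ≡ k + f
mexFrom-stops zero k l = inj₂ (sym (+-identityʳ k))
mexFrom-stops (suc f) k l with elem k l in k∈?
... | false = inj₁ (elem-false⇒∉ k∈?)
... | true = Sum.map₂ (λ eq → trans eq (sym (+-suc k f))) (mexFrom-stops f (suc k) l)

range⊆⇒≤length : ∀ n l → (∀ v → v < n → v ∈ l) → n ≤ length l
range⊆⇒≤length zero l _ = z≤n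
range⊆⇒≤length (suc n) l range⊆l with ∈-∃++ (range⊆l n ≤-refl)
... | ys , zs , refl =
  subst (suc n ≤_) (sym (length-++-sucʳ ys n zs))
        (s≤s (range⊆⇒≤length n (ys ++ zs) (λ v v<n → drop-n v<n (range⊆l v (m≤n⇒m≤1+n v<n)))))
  where
  drop-n : ∀ {v} → v < n → v ∈ ys ++ n ∷ zs → v ∈ ys ++ zs
  drop-n v<n v∈ with ∈-++⁻ ys v∈
  ... | inj₁ v∈ys = ∈-++⁺ˡ v∈ys
  ... | inj₂ (here refl) = ⊥-elim (<-irrefl refl v<n)
  ... | inj₂ (there v∈zs) = ∈-++⁺ʳ ys v∈zs

mex-below : ∀ l v → v < mex l → v ∈ l
mex-below l v = mexFrom-skips (suc (length l)) 0 l v z≤n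

mex-∉ : ∀ l → mex l ∉ l
mex-∉ l with mexFrom-stops (suc (length l)) 0 l
... | inj₁ fresh = fresh
... | inj₂ exhausted = ⊥-elim (<-irrefl refl (range⊆⇒≤length (suc (length l)) l
        (λ v v< → mex-below l v (subst (v <_) (sym exhausted) v<))))

-- Any fuel exceeding the total gives the same value, since moves lower it.
grundyF-fuel : ∀ f g x → total x < f → total x < g → grundyF f x ≡ grundyF g x
grundyF-fuel (suc f) (suc g) x tx<f tx<g = cong mex (map-cong-local (tabulate same))
  where
  same : ∀ {y} → y ∈ moves x → grundyF f y ≡ grundyF g y
  same {y} y∈ = let ty<tx = move-total (moves⁻ {x} y∈) in
    grundyF-fuel f g y (<-≤-trans ty<tx (s≤s⁻¹ tx<f)) (<-≤-trans ty<tx (s≤s⁻¹ tx<g))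

𝒢-unfold : ∀ x → 𝒢 x ≡ mex (map 𝒢 (moves x))
𝒢-unfold x = cong mex (map-cong-local (tabulate λ {y} y∈ →
  grundyF-fuel (total x) (suc (total y)) y (move-total (moves⁻ {x} y∈)) ≤-refl))

option-≢ : ∀ {x y} → Move x y → 𝒢 y ≢ 𝒢 x
option-≢ {x} m 𝒢y≡𝒢x = mex-∉ (map 𝒢 (moves x))
  (subst (_∈ map 𝒢 (moves x)) (trans 𝒢y≡𝒢x (𝒢-unfold x)) (∈-map⁺ 𝒢 (moves⁺ m)))

Reaches : Pos → ℕ → Set
Reaches x v = ∃ λ y → Move x y × 𝒢 y ≡ v

Covers : Pos → ℕ → Set
Covers x k = ∀ v → v < k → Reaches x v

covers-𝒢 : ∀ x → Covers x (𝒢 x)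
covers-𝒢 x v v<𝒢 with ∈-map⁻ 𝒢 (mex-below (map 𝒢 (moves x)) v (subst (v <_) (𝒢-unfold x) v<𝒢))
... | y , y∈ , refl = y , moves⁻ y∈ , refl

-- Covering k forces 𝒢 x ≥ k, for otherwise 𝒢 x itself would be reached.
covers⇒≤ : ∀ {x k} → Covers x k → k ≤ 𝒢 x
covers⇒≤ {x} cov = ≮⇒≥ λ 𝒢<k → let _ , m , e = cov (𝒢 x) 𝒢<k in option-≢ m e

move-rec : (P : Pos → Set) → (∀ x → (∀ {y} → Move x y → P y) → P x) → ∀ x → P x
move-rec P step x = bounded (suc (total x)) x ≤-refl
  where
  bounded : ∀ n x → total x < n → P x
  bounded (suc n) x tx<n = step x λ m → bounded n _ (<-≤-trans (move-total m) (s≤s⁻¹ tx<n))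

𝒢≤total : ∀ x → 𝒢 x ≤ total x
𝒢≤total = move-rec (λ x → 𝒢 x ≤ total x) λ x ih → ≮⇒≥ λ tx<𝒢 →
  let _ , m , e = covers-𝒢 x (total x) tx<𝒢 in
  <-irrefl e (≤-<-trans (ih m) (move-total m))

covers-total⇒exact : ∀ {x} → Covers x (total x) → 𝒢 x ≡ total x
covers-total⇒exact {x} cov = ≤-antisym (𝒢≤total x) (covers⇒≤ cov)

lower-pile0 : ∀ {a' a b c} → a' < a → Move (a , b , c) (a' , b , c)
lower-pile0 {c = c} a'<a =
  mv (<⇒≤ a'<a) ≤-refl ≤-refl (+-monoˡ-< c (+-monoˡ-< _ a'<a)) (inj₁ refl)

raise-option : ∀ {a' a b c y} → a' ≤ a → Move (a' , b , c) y → Move (a , b , c) y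
raise-option {b = b} {c} a'≤a (mv p q r t o) =
  mv (≤-trans p a'≤a) q r (<-≤-trans t (+-monoˡ-≤ c (+-monoˡ-≤ b a'≤a))) o

reaches-via-pile0 : ∀ {a' a b c v} → a' < a → v ≤ 𝒢 (a' , b , c) → Reaches (a , b , c) v
reaches-via-pile0 a'<a v≤𝒢 with m≤n⇒m<n∨m≡n v≤𝒢
... | inj₂ v≡𝒢 = _ , lower-pile0 a'<a , sym v≡𝒢
... | inj₁ v<𝒢 = let y , m , e = covers-𝒢 _ _ v<𝒢 in y , raise-option (<⇒≤ a'<a) m , e

pile0-gain : ∀ a b c → a + 𝒢 (0 , b , c) ≤ 𝒢 (a , b , c)
pile0-gain zero b c = ≤-refl
pile0-gain (suc a) b c =
  covers⇒≤ {suc a , b , c} λ v v≤ → reaches-via-pile0 ≤-refl (≤-trans (s≤s⁻¹ v≤) (pile0-gain a b c))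

module Column (b : ℕ) (narrower : ∀ b' → b' < b → ∀ c → c ≤ b' + 𝒢 (0 , b' , c)) where

  Hit : ℕ → ℕ → Set
  Hit c v = ∃ λ c' → c' < c × 𝒢 (0 , b , c') ≡ v

  hit⇒reaches : ∀ {c v} → Hit c v → Reaches (0 , b , c) v
  hit⇒reaches (c' , c'<c , e) =
    (0 , b , c') , mv z≤n ≤-refl (<⇒≤ c'<c) (+-monoʳ-< b c'<c) (inj₁ refl) , e

  narrower-misses : ∀ {b' c v} → v + b ≡ c → b' < b → 𝒢 (0 , b' , c) ≢ v
  narrower-misses {b'} {c} {v} v+b≡c b'<b 𝒢≡v = <-irrefl refl (begin-strict
    c                      ≤⟨ narrower b' b'<b c ⟩
    b' + 𝒢 (0 , b' , c)    ≡⟨ cong (b' +_) 𝒢≡v ⟩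
    b' + v                 <⟨ +-monoˡ-< v b'<b ⟩
    b + v                  ≡⟨ trans (+-comm b v) v+b≡c ⟩
    c                      ∎)
    where open ≤-Reasoning

  -- If all u < v were hit below height c = v + b, then v is taken at some c' ≤ c:
  -- an option of (0 , b , c) with value v cannot leave the column.
  new-value : ∀ c v → v + b ≡ c → (∀ u → u < v → Hit c u) →
              ∃ λ c' → c' ≤ c × 𝒢 (0 , b , c') ≡ v
  new-value c v v+b≡c earlier with m≤n⇒m<n∨m≡n (covers⇒≤ λ u u<v → hit⇒reaches (earlier u u<v))
  ... | inj₂ v≡𝒢 = c , ≤-refl , sym v≡𝒢
  ... | inj₁ v<𝒢 with covers-𝒢 (0 , b , c) v v<𝒢
  ...   | _ , mv z≤n _ y2≤c _ (inj₁ refl) , e = _ , y2≤c , e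
  ...   | _ , mv z≤n _ _ t (inj₂ refl) , e =
          ⊥-elim (narrower-misses v+b≡c (+-cancelʳ-< c _ b t) e)

  hits : ∀ c v → v + b < c → Hit c v
  hits (suc c) v v+b<1+c with m≤n⇒m<n∨m≡n (s≤s⁻¹ v+b<1+c)
  ... | inj₁ v+b<c = let c' , c'<c , e = hits c v v+b<c in c' , m<n⇒m<1+n c'<c , e
  ... | inj₂ v+b≡c =
    let c' , c'≤c , e = new-value c v v+b≡c
                          (λ u u<v → hits c u (subst (u + b <_) v+b≡c (+-monoˡ-< b u<v)))
    in c' , s≤s c'≤c , e

  bound : ∀ c → c ≤ b + 𝒢 (0 , b , c)
  bound c with b ≤? c
  ... | no b≰c = ≤-trans (<⇒≤ (≰⇒> b≰c)) (m≤m+n b _)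
  ... | yes b≤c = begin
    c                      ≡⟨ sym (m+[n∸m]≡n b≤c) ⟩
    b + (c ∸ b)            ≤⟨ +-monoʳ-≤ b (covers⇒≤ λ v v< →
                                hit⇒reaches (hits c v (m≤o∸n⇒m+n≤o (suc v) b≤c v<))) ⟩
    b + 𝒢 (0 , b , c)      ∎
    where open ≤-Reasoning

column-bound : ∀ b c → c ≤ b + 𝒢 (0 , b , c)
column-bound = <-rec _ λ b ih → Column.bound b λ b' → ih {b'}

Balanced : Pos → Set
Balanced (a , b , c) = b ≤ a

BalancedOptionsExact : Pos → Set
BalancedOptionsExact x = ∀ {y} → Move x y → Balanced y → 𝒢 y ≡ total y

reach-high-small : ∀ {a b c w} → BalancedOptionsExact (a , b , c) →
                   w ≤ a → w + c < a + b + c → Reaches (a , b , c) (w + c)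
reach-high-small {a} {b} {c} {w} ih w≤a lt =
  (w , 0 , c) , m , trans (ih m z≤n) w+0+c≡w+c
  where
  w+0+c≡w+c : w + 0 + c ≡ w + c
  w+0+c≡w+c = cong (_+ c) (+-identityʳ w)
  m : Move (a , b , c) (w , 0 , c)
  m = mv w≤a z≤n ≤-refl (subst (_< a + b + c) (sym w+0+c≡w+c) lt) (inj₂ refl)

reach-high-large : ∀ {a b c k} → BalancedOptionsExact (a , b , c) →
                   b ≤ a → k < b → Reaches (a , b , c) (a + k + c)
reach-high-large {a} {c = c} ih b≤a k<b =
  (a , _ , c) , m , ih m (≤-trans (<⇒≤ k<b) b≤a)
  where
  m = mv ≤-refl (<⇒≤ k<b) ≤-refl (+-monoˡ-< c (+-monoʳ-< a k<b)) (inj₂ refl)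

reach-high : ∀ {a b c} → BalancedOptionsExact (a , b , c) → b ≤ a →
             ∀ w → w + c < a + b + c → Reaches (a , b , c) (w + c)
reach-high {a} {b} {c} ih b≤a w lt with w ≤? a
... | yes w≤a = reach-high-small ih w≤a lt
... | no w≰a = subst (Reaches _) (cong (_+ c) (m+[n∸m]≡n a≤w)) (reach-high-large ih b≤a w∸a<b)
  where
  a≤w = <⇒≤ (≰⇒> w≰a)
  w∸a<b : w ∸ a < b
  w∸a<b = subst (w ∸ a <_) (m+n∸m≡n a b) (∸-monoˡ-< (+-cancelʳ-< c w (a + b) lt) a≤w)

-- Every value below c is reached: by (0 , 0 , v) if a = 0, and otherwise by
-- lowering pile 0, since v < c ≤ b + 𝒢 (0 , b , c) ≤ 1 + 𝒢 (a - 1 , b , c).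
reach-low : ∀ a b c → b ≤ a → BalancedOptionsExact (a , b , c) →
            ∀ {v} → v < c → Reaches (a , b , c) v
reach-low zero .zero c z≤n ih {v} v<c = (0 , 0 , v) , m , ih m z≤n
  where m = mv z≤n z≤n (<⇒≤ v<c) v<c (inj₁ refl)
reach-low (suc a) b c b≤a _ {v} v<c = reaches-via-pile0 ≤-refl (≤-trans (s≤s⁻¹ v<1+) (pile0-gain a b c))
  where
  v<1+ : v < suc a + 𝒢 (0 , b , c)
  v<1+ = <-≤-trans v<c (≤-trans (column-bound b c) (+-monoˡ-≤ _ b≤a))

balanced-covers : ∀ a b c → b ≤ a → BalancedOptionsExact (a , b , c) →
                  Covers (a , b , c) (a + b + c)
balanced-covers a b c b≤a ih v v< with c ≤? v
... | no c≰v = reach-low a b c b≤a ih (≰⇒> c≰v)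
... | yes c≤v = subst (Reaches _) (m∸n+n≡m c≤v)
                  (reach-high ih b≤a (v ∸ c) (subst (_< a + b + c) (sym (m∸n+n≡m c≤v)) v<))

balanced-exact : ∀ x → Balanced x → 𝒢 x ≡ total x
balanced-exact = move-rec (λ x → Balanced x → 𝒢 x ≡ total x)
  λ { (a , b , c) ih b≤a → covers-total⇒exact (balanced-covers a b c b≤a ih) }

corollary4p10 : (x₀ x₁ x₂ : ℕ) → x₁ ≤ x₀ → 𝒢 (x₀ , x₁ , x₂) ≡ x₀ + x₁ + x₂
corollary4p10 x₀ x₁ x₂ = balanced-exact (x₀ , x₁ , x₂)
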